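{- For a $2$-tree $G$, the algorithm described below lists all spanning trees of $G$ without repetition.
   Context: A $2$-tree is a graph obtained from the graph consisting of two adjacent vertices by iteratively adding one new vertex whose neighborhood consists of two adjacent vertices. A vertex is simplicial if its neighborhood is a clique. A $2$-simplicial ordering of an $n$-vertex $2$-tree $G$ ($n\ge 2$) is an ordering $(v_n,\ldots,v_1)$ of $V(G)$ such that, writing $G_i=G[\{v_i,\ldots,v_1\}]$, each $v_i$ with $i\ge 3$ is a simplicial vertex of degree $2$ in $G_i$ (so $G_2\cong K_2$). The algorithm takes as input $G$ with a $2$-simplicial ordering $(v_n,\ldots,v_1)$. It initializes a list with the single spanning tree of $G_2$. Then, for $i=3,\ldots,n$: letting $\{x,y\}$ be the neighborhood of $v_i$ among $\{v_{i-1},\ldots,v_1\}$, for each spanning tree $T$ of $G_{i-1}$ in the list, it appends the two spanning trees of $G_i$ obtained by adding the edge $v_ix$ or the edge $v_iy$ to $T$, and, if $xy\in E(T)$, it also appends the spanning tree of $G_i$ obtained from $T$ by replacing the edge $xy$ with the edges $v_ix$ and $v_iy$. The output is the list of spanning trees of $G_n=G$ so produced. -}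

module Defs where

open import Data.Bool using (Bool; true; false; if_then_else_; _∧_)
open import Data.Nat using (ℕ; zero; suc; _<_; _≤_; _<ᵇ_; _≤ᵇ_)
open import Data.Fin using (Fin; zero; suc; toℕ; _≟_)
open import Data.Fin.Properties using () renaming (_≟_ to _≟F_)
open import Data.List using (List; []; _∷_; _++_; length; filterᵇ; map; concatMap; foldl)
open import Data.List.Relation.Unary.Unique.Propositional using (Unique)
open import Data.List.Membership.Propositional using (_∈_)
open import Data.Vec using (Vec; lookup; replicate; _[_]≔_)
open import Data.Unit using (⊤)
open import Data.Fin using () renaming (_≟_ to _≟Fin_)
open import Data.List using () renaming (allFin to allFinL)
open import Data.Product using (Σ; ∃; _×_; _,_)
open import Relation.Binary.PropositionalEquality using (_≡_; _≢_)
open import Relation.Nullary using (¬_; does)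
open import Function.Definitions using (Injective)

-- Using Vec (rather than functions) makes _≡_ on graphs extensional,
-- so "the same spanning tree" is literally propositional equality.

Adj : ℕ → Set
Adj n = Vec (Vec Bool n) n

adj : ∀ {n} → Adj n → Fin n → Fin n → Bool
adj A u v = lookup (lookup A u) v

Edge : ∀ {n} → Adj n → Fin n → Fin n → Set
Edge A u v = adj A u v ≡ true

IsSimpleGraph : ∀ {n} → Adj n → Set
IsSimpleGraph A = (∀ u v → adj A u v ≡ adj A v u) × (∀ u → adj A u u ≡ false)

data Walk {n} (A : Adj n) : Fin n → Fin n → Set where
  here : ∀ {u} → Walk A u u
  step : ∀ {u w v} → Edge A u w → Walk A w v → Walk A u v

Connected : ∀ {n} → Adj n → Set
Connected A = ∀ u v → Walk A u v

Chain : ∀ {n} → Adj n → List (Fin n) → Set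
Chain A []           = ⊤
Chain A (u ∷ [])     = ⊤
Chain A (u ∷ v ∷ vs) = Edge A u v × Chain A (v ∷ vs)

lastOr : ∀ {a} {X : Set a} → X → List X → X
lastOr x []       = x
lastOr x (y ∷ ys) = lastOr y ys

HasCycle : ∀ {n} → Adj n → Set
HasCycle {n} A = Σ (Fin n) λ v → Σ (List (Fin n)) λ ws →
  (2 ≤ length ws) × Unique (v ∷ ws) × Chain A (v ∷ ws) × Edge A (lastOr v ws) v

Acyclic : ∀ {n} → Adj n → Set
Acyclic A = ¬ HasCycle A

IsTree : ∀ {n} → Adj n → Set
IsTree A = IsSimpleGraph A × Connected A × Acyclic A

Subgraph : ∀ {n} → Adj n → Adj n → Set
Subgraph T G = ∀ u v → Edge T u v → Edge G u v

IsSpanningTree : ∀ {n} → Adj n → Adj n → Set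
IsSpanningTree G T = Subgraph T G × IsTree T

-- Vertex orderings.  An ordering (v_n, …, v_1) of V(G) is given by an
-- injective (hence bijective) map σ : Fin n → Fin n, with σ i = v_(i+1).
-- G_i is the subgraph induced by {σ j | j < i}.

Ordering : ℕ → Set
Ordering n = Σ (Fin n → Fin n) λ σ → Injective _≡_ _≡_ σ

SimplicialDeg2 : ∀ {n} → Adj n → (Fin n → Fin n) → Fin n → Set
SimplicialDeg2 {n} G σ i = Σ (Fin n) λ a → Σ (Fin n) λ b →
  (toℕ a < toℕ i) × (toℕ b < toℕ i) × (a ≢ b) ×
  (∀ j → toℕ j < toℕ i → (Edge G (σ i) (σ j) → (j ≡ a Data.Sum.⊎ j ≡ b)) × ((j ≡ a Data.Sum.⊎ j ≡ b) → Edge G (σ i) (σ j))) ×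
  Edge G (σ a) (σ b)
  where import Data.Sum

-- 2-simplicial ordering: each v_i with i ≥ 3 (0-based index ≥ 2) is
-- simplicial of degree 2 in G_i
Is2SimplicialOrdering : ∀ {n} → Adj n → Ordering n → Set
Is2SimplicialOrdering G (σ , _) = ∀ i → 2 ≤ toℕ i → SimplicialDeg2 G σ i

-- 2-tree: obtained from K_2 (on v_1 v_2) by iteratively adding a vertex
-- whose neighbourhood (at the time it is added) is two adjacent vertices.
-- The order of addition is recorded by an ordering τ.
IsTwoTree : ∀ {n} → Adj n → Set
IsTwoTree {n} G = IsSimpleGraph G × Σ (Ordering n) λ τ →
  (Σ (Fin n) λ a → Σ (Fin n) λ b → toℕ a ≡ 0 × toℕ b ≡ 1 ×
       Edge G (Data.Product.proj₁ τ a) (Data.Product.proj₁ τ b))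
  × Is2SimplicialOrdering G τ
  where import Data.Product

addEdge : ∀ {n} → Fin n → Fin n → Adj n → Adj n
addEdge u v T = (T [ u ]≔ (lookup T u [ v ]≔ true)) [ v ]≔
                  (lookup (T [ u ]≔ (lookup T u [ v ]≔ true)) v [ u ]≔ true)

removeEdge : ∀ {n} → Fin n → Fin n → Adj n → Adj n
removeEdge u v T = (T [ u ]≔ (lookup T u [ v ]≔ false)) [ v ]≔
                  (lookup (T [ u ]≔ (lookup T u [ v ]≔ false)) v [ u ]≔ false)

emptyGraph : ∀ {n} → Adj n
emptyGraph = replicate _ (replicate _ false)

earlierNbrs : ∀ {n} → Adj n → (Fin n → Fin n) → Fin n → List (Fin n)
earlierNbrs {n} G σ i =
  map σ (filterᵇ (λ j → (toℕ j <ᵇ toℕ i) ∧ adj G (σ i) (σ j)) (allFinL n))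

-- one extension step applied to a single spanning tree T of G_(i-1),
-- new vertex v with earlier neighbourhood {x , y}
extend : ∀ {n} → Fin n → Fin n → Fin n → Adj n → List (Adj n)
extend v x y T =
  addEdge v x T ∷ addEdge v y T ∷
  (if adj T x y then addEdge v y (addEdge v x (removeEdge x y T)) ∷ [] else [])

-- processing vertex σ i (i ≥ 2); if the input is not a 2-simplicial
-- ordering (neighbourhood not of size 2) we return the empty list
stepAlg : ∀ {n} → Adj n → (Fin n → Fin n) → List (Adj n) → Fin n → List (Adj n)
stepAlg G σ L i with earlierNbrs G σ i
... | x ∷ y ∷ [] = concatMap (extend (σ i) x y) L
... | _          = []

algorithm : ∀ {m} → Adj (suc (suc m)) → Ordering (suc (suc m)) → List (Adj (suc (suc m)))
algorithm {m} G (σ , _) =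
  foldl (stepAlg G σ)
        (addEdge (σ zero) (σ (suc zero)) emptyGraph ∷ [])
        (filterᵇ (λ i → 2 ≤ᵇ toℕ i) (allFinL (suc (suc m))))

module Submission where

-- Let G_i be the graph induced by the first i vertices, and let v be the next vertex, whose
-- neighbours in G_(i+1) are the adjacent vertices x and y. A spanning tree T′ of G_(i+1) contains
-- vx, vy or both. In the first two cases v is a leaf and T′ − v is a spanning tree of G_i; in the
-- third, T′ is a spanning tree T of G_i through xy with that edge subdivided by v (the triangle
-- v x y cannot lie in T′). Conversely these operations send spanning trees of G_i to spanning
-- trees of G_(i+1). So extending each spanning tree of G_i in the three ways lists the spanning
-- trees of G_(i+1), and without repetition: the three extensions of T differ at v, and T is
-- recovered from each of them by deleting v and restoring xy when both vx and vy are present.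

open import Defs
open import Data.Bool using (Bool; true; false; if_then_else_; _∧_)
open import Data.Bool.Properties using (¬-not; not-¬; ⇔→≡; ∧-zeroʳ; T-∧; T-≡) renaming (_≟_ to _≟ᵇ_)
open import Data.Nat using (ℕ; zero; suc; _+_; _≤_; _<_; s≤s; z≤n; _<ᵇ_; _≤ᵇ_)
open import Data.Nat.Properties
  using (<ᵇ⇒<; <⇒<ᵇ; m<n⇒m<1+n; m<1+n⇒m<n∨m≡n; n<1+n; m≤n⇒m≤1+n; +-suc; +-identityʳ; 1+n≰n; <-irrefl; 0≢1+n)
open import Data.Fin using (Fin; zero; suc; toℕ; _≟_; punchOut)
open import Data.Fin.Properties using (toℕ-injective; toℕ<n; punchOut-injective; injective⇒≤) renaming (any? to anyFin?)
open import Data.Vec using (Vec; lookup; _[_]≔_)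
open import Data.Vec.Properties using (lookup∘update; lookup∘update′; tabulate∘lookup; tabulate-cong; lookup-replicate)
open import Data.List using (List; []; _∷_; _++_; length; concatMap; map; filterᵇ; tabulate; allFin; foldl)
open import Data.List.Properties using (++-assoc; filter-all)
open import Data.List.Relation.Unary.All as All using (All; []; _∷_)
open import Data.List.Relation.Unary.All.Properties using (++⁺; ¬Any⇒All¬; tabulate⁺)
open import Data.List.Relation.Unary.AllPairs using ([]; _∷_)
open import Data.List.Relation.Unary.Any using (here; there; any?)
open import Data.List.Relation.Unary.Unique.Propositional using (Unique)
import Data.List.Relation.Unary.Unique.Propositional.Properties as Unique
open import Data.List.Relation.Binary.Disjoint.Propositional using (Disjoint)
open import Data.List.Membership.Propositional using (_∈_; find; lose)
open import Data.List.Membership.Propositional.Properties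
  using (∈-∃++; ∈-concatMap⁺; ∈-concatMap⁻; ∈-filter⁺; ∈-filter⁻; ∈-allFin)
open import Data.Product using (∃; ∃₂; _×_; _,_; proj₁; proj₂) renaming (swap to ×-swap)
open import Data.Sum using (_⊎_; inj₁; inj₂; [_,_]′) renaming (swap to ⊎-swap; map to ⊎-map)
open import Data.Empty using (⊥-elim)
open import Data.Unit using (⊤; tt)
open import Function using (_∘_; id)
open import Function.Bundles using (mk⇔; Equivalence)
open import Function.Definitions using (Injective)
open import Level using (0ℓ)
open import Relation.Binary.PropositionalEquality using (_≡_; _≢_; refl; sym; trans; cong; subst; module ≡-Reasoning)
open import Relation.Nullary using (¬_; Dec; yes; no)
open import Relation.Nullary.Decidable using (T?; _×-dec_; _⊎-dec_)
open import Relation.Unary using (Pred; _∪_; ｛_｝; _≐_)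

private
  variable
    n : ℕ
    a b u v w x y z : Fin n
    A B M N T : Adj n

-- Unordered pairs and edge updates

SamePair : Fin n → Fin n → Fin n → Fin n → Set
SamePair u w a b = (a ≡ u × b ≡ w) ⊎ (a ≡ w × b ≡ u)

samePair? : (u w a b : Fin n) → Dec (SamePair u w a b)
samePair? u w a b = (a ≟ u ×-dec b ≟ w) ⊎-dec (a ≟ w ×-dec b ≟ u)

SamePair-swapˡ : SamePair u w a b → SamePair w u a b
SamePair-swapˡ (inj₁ p) = inj₂ p
SamePair-swapˡ (inj₂ p) = inj₁ p

SamePair-swapʳ : SamePair u w a b → SamePair u w b a
SamePair-swapʳ (inj₁ (p , q)) = inj₂ (q , p)
SamePair-swapʳ (inj₂ (p , q)) = inj₁ (q , p)

SamePair-sym : SamePair u w a b → SamePair a b u w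
SamePair-sym (inj₁ (refl , refl)) = inj₁ (refl , refl)
SamePair-sym (inj₂ (refl , refl)) = inj₂ (refl , refl)

SamePair⇒∈ : SamePair u w a b → a ≡ u ⊎ a ≡ w
SamePair⇒∈ (inj₁ (a≡u , _)) = inj₁ a≡u
SamePair⇒∈ (inj₂ (a≡w , _)) = inj₂ a≡w

SamePair⇒∋ : SamePair u w a b → u ≡ a ⊎ u ≡ b
SamePair⇒∋ (inj₁ (refl , _)) = inj₁ refl
SamePair⇒∋ (inj₂ (_ , refl)) = inj₂ refl

SamePair-covers : SamePair x y u w → a ≡ x ⊎ a ≡ y → a ≡ u ⊎ a ≡ w
SamePair-covers p (inj₁ refl) = SamePair⇒∋ p
SamePair-covers p (inj₂ refl) = SamePair⇒∋ (SamePair-swapˡ p)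

SamePair-other : x ≢ y → SamePair x y a b → SamePair x y u a → u ≡ b
SamePair-other x≢y (inj₁ (refl , refl)) (inj₁ (_ , refl)) = ⊥-elim (x≢y refl)
SamePair-other x≢y (inj₁ (refl , refl)) (inj₂ (refl , _)) = refl
SamePair-other x≢y (inj₂ (refl , refl)) (inj₁ (refl , _)) = refl
SamePair-other x≢y (inj₂ (refl , refl)) (inj₂ (_ , refl)) = ⊥-elim (x≢y refl)

SamePair-fromDistinct : a ≡ x ⊎ a ≡ y → b ≡ x ⊎ b ≡ y → a ≢ b → SamePair x y a b
SamePair-fromDistinct (inj₁ refl) (inj₁ refl) a≢b = ⊥-elim (a≢b refl)
SamePair-fromDistinct (inj₁ p)    (inj₂ q)    _   = inj₁ (p , q)
SamePair-fromDistinct (inj₂ p)    (inj₁ q)    _   = inj₂ (p , q)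
SamePair-fromDistinct (inj₂ refl) (inj₂ refl) a≢b = ⊥-elim (a≢b refl)

setArc : Bool → Fin n → Fin n → Adj n → Adj n
setArc c u w T = T [ u ]≔ (lookup T u [ w ]≔ c)

adj-setArc-≡ : ∀ c u w (T : Adj n) → adj (setArc c u w T) u w ≡ c
adj-setArc-≡ c u w T = begin
  lookup (lookup (setArc c u w T) u) w ≡⟨ cong (λ r → lookup r w) (lookup∘update u T _) ⟩
  lookup (lookup T u [ w ]≔ c) w       ≡⟨ lookup∘update w (lookup T u) c ⟩
  c                                    ∎
  where open ≡-Reasoning

adj-setArc-≢ : ∀ c u w (T : Adj n) → a ≢ u ⊎ b ≢ w → adj (setArc c u w T) a b ≡ adj T a b
adj-setArc-≢ c u w T (inj₁ a≢u) = cong (λ r → lookup r _) (lookup∘update′ a≢u T _)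
adj-setArc-≢ {a = a} c u w T (inj₂ b≢w) with a ≟ u
... | yes refl = trans (cong (λ r → lookup r _) (lookup∘update u T _)) (lookup∘update′ b≢w (lookup T u) c)
... | no a≢u   = adj-setArc-≢ c u w T (inj₁ a≢u)

-- addEdge u w and removeEdge u w unfold to setEdge true u w and setEdge false u w.
setEdge : Bool → Fin n → Fin n → Adj n → Adj n
setEdge c u w T = setArc c w u (setArc c u w T)

adj-setEdge-≡ : ∀ c u w (T : Adj n) → SamePair u w a b → adj (setEdge c u w T) a b ≡ c
adj-setEdge-≡ c u w T (inj₂ (refl , refl)) = adj-setArc-≡ c w u (setArc c u w T)
adj-setEdge-≡ c u w T (inj₁ (refl , refl)) with u ≟ w
... | yes refl = adj-setArc-≡ c u u (setArc c u u T)
... | no u≢w   = trans (adj-setArc-≢ c w u (setArc c u w T) (inj₁ u≢w)) (adj-setArc-≡ c u w T)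

adj-setEdge-≢ : ∀ c u w (T : Adj n) → ¬ SamePair u w a b → adj (setEdge c u w T) a b ≡ adj T a b
adj-setEdge-≢ {a = a} {b} c u w T ¬p = trans (adj-setArc-≢ c w u (setArc c u w T) outer) (adj-setArc-≢ c u w T inner)
  where
  outer : a ≢ w ⊎ b ≢ u
  outer with a ≟ w
  ... | yes refl = inj₂ λ b≡u → ¬p (inj₂ (refl , b≡u))
  ... | no a≢w   = inj₁ a≢w
  inner : a ≢ u ⊎ b ≢ w
  inner with a ≟ u
  ... | yes refl = inj₂ λ b≡w → ¬p (inj₁ (refl , b≡w))
  ... | no a≢u   = inj₁ a≢u

Edge? : ∀ (T : Adj n) a b → Dec (Edge T a b)
Edge? T a b = adj T a b ≟ᵇ true

Edge-ext : (∀ {a b} → Edge M a b → Edge N a b) → (∀ {a b} → Edge N a b → Edge M a b) → M ≡ N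
Edge-ext {M = M} {N} to from = vec-ext M N λ a → vec-ext (lookup M a) (lookup N a) λ b → ⇔→≡ (mk⇔ to from)
  where
  vec-ext : ∀ {X : Set} {k} (xs ys : Vec X k) → (∀ i → lookup xs i ≡ lookup ys i) → xs ≡ ys
  vec-ext xs ys eq = trans (sym (tabulate∘lookup xs)) (trans (tabulate-cong eq) (tabulate∘lookup ys))

≢-byEdge : ∀ a b → Edge N a b → ¬ Edge M a b → M ≢ N
≢-byEdge a b e ¬e refl = ¬e e

record Undirected (T : Adj n) : Set where
  constructor mkUndirected
  field adj-comm : ∀ a b → adj T a b ≡ adj T b a

record Loopless (T : Adj n) : Set where
  constructor mkLoopless
  field adj-loop : ∀ a → adj T a a ≡ false

open Undirected
open Loopless

Isolated : Adj n → Fin n → Set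
Isolated T v = ∀ b → ¬ Edge T v b

Edge-flip : Undirected T → Edge T a b → Edge T b a
Edge-flip {a = a} {b} und e = trans (adj-comm und b a) e

Edge-SamePair : Undirected T → SamePair u w a b → Edge T u w → Edge T a b
Edge-SamePair und (inj₁ (refl , refl)) e = e
Edge-SamePair und (inj₂ (refl , refl)) e = Edge-flip und e

Loopless⇒¬Edge : Loopless T → ¬ Edge T a a
Loopless⇒¬Edge {a = a} loopless = not-¬ (adj-loop loopless a)

Isolated⇒≢ : ∀ T → Isolated T v → Edge T a b → v ≢ a
Isolated⇒≢ T isolated e refl = isolated _ e

Isolated⇒¬SamePair : Undirected T → Isolated T v → Edge T a b → ¬ SamePair v w a b
Isolated⇒¬SamePair und isolated e (inj₁ (refl , _)) = isolated _ e
Isolated⇒¬SamePair und isolated e (inj₂ (_ , refl)) = isolated _ (Edge-flip und e)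

setEdge-undirected : ∀ c u w → Undirected T → Undirected (setEdge c u w T)
setEdge-undirected {T = T} c u w und = mkUndirected comm
  where
  comm : ∀ a b → adj (setEdge c u w T) a b ≡ adj (setEdge c u w T) b a
  comm a b with samePair? u w a b
  ... | yes p = trans (adj-setEdge-≡ c u w T p) (sym (adj-setEdge-≡ c u w T (SamePair-swapʳ p)))
  ... | no ¬p = begin
    adj (setEdge c u w T) a b ≡⟨ adj-setEdge-≢ c u w T ¬p ⟩
    adj T a b                 ≡⟨ adj-comm und a b ⟩
    adj T b a                 ≡⟨ adj-setEdge-≢ c u w T (¬p ∘ SamePair-swapʳ) ⟨
    adj (setEdge c u w T) b a ∎
    where open ≡-Reasoning

removeEdge-loopless : ∀ u w → Loopless T → Loopless (removeEdge u w T)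
removeEdge-loopless {T = T} u w loopless = mkLoopless loop
  where
  loop : ∀ a → adj (removeEdge u w T) a a ≡ false
  loop a with samePair? u w a a
  ... | yes p = adj-setEdge-≡ false u w T p
  ... | no ¬p = trans (adj-setEdge-≢ false u w T ¬p) (adj-loop loopless a)

addEdge-loopless : u ≢ w → Loopless T → Loopless (addEdge u w T)
addEdge-loopless {u = u} {w} {T} u≢w loopless = mkLoopless loop
  where
  loop : ∀ a → adj (addEdge u w T) a a ≡ false
  loop a with samePair? u w a a
  ... | yes (inj₁ (refl , refl)) = ⊥-elim (u≢w refl)
  ... | yes (inj₂ (refl , refl)) = ⊥-elim (u≢w refl)
  ... | no ¬p                    = trans (adj-setEdge-≢ true u w T ¬p) (adj-loop loopless a)

addEdge-new : ∀ u w (T : Adj n) → SamePair u w a b → Edge (addEdge u w T) a b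
addEdge-new u w T = adj-setEdge-≡ true u w T

addEdge-keep : ∀ u w (T : Adj n) → Edge T a b → Edge (addEdge u w T) a b
addEdge-keep {a = a} {b} u w T e with samePair? u w a b
... | yes p = adj-setEdge-≡ true u w T p
... | no ¬p = trans (adj-setEdge-≢ true u w T ¬p) e

addEdge⁻ : ∀ u w (T : Adj n) → Edge (addEdge u w T) a b → SamePair u w a b ⊎ Edge T a b
addEdge⁻ {a = a} {b} u w T e with samePair? u w a b
... | yes p = inj₁ p
... | no ¬p = inj₂ (trans (sym (adj-setEdge-≢ true u w T ¬p)) e)

addEdge-neighbour : ∀ T → v ≢ z → Isolated T v → Edge (addEdge v z T) v w → w ≡ z
addEdge-neighbour {v = v} {z} T v≢z isolated e with addEdge⁻ v z T e
... | inj₁ (inj₁ (_ , w≡z)) = w≡z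
... | inj₁ (inj₂ (v≡z , _)) = ⊥-elim (v≢z v≡z)
... | inj₂ e′               = ⊥-elim (isolated _ e′)

removeEdge-keep : ∀ u w (T : Adj n) → ¬ SamePair u w a b → Edge T a b → Edge (removeEdge u w T) a b
removeEdge-keep u w T ¬p e = trans (adj-setEdge-≢ false u w T ¬p) e

removeEdge⁻ : ∀ u w (T : Adj n) → Edge (removeEdge u w T) a b → ¬ SamePair u w a b × Edge T a b
removeEdge⁻ {a = a} {b} u w T e with samePair? u w a b
... | yes p = ⊥-elim (not-¬ (adj-setEdge-≡ false u w T p) e)
... | no ¬p = ¬p , trans (sym (adj-setEdge-≢ false u w T ¬p)) e

adj-emptyGraph : ∀ (a b : Fin n) → adj emptyGraph a b ≡ false
adj-emptyGraph a b = trans (cong (λ r → lookup r b) (lookup-replicate a _)) (lookup-replicate b false)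

¬Edge-emptyGraph : ∀ (a b : Fin n) → ¬ Edge emptyGraph a b
¬Edge-emptyGraph a b = not-¬ (adj-emptyGraph a b)

-- Walks and cycles

_++ʷ_ : Walk A u w → Walk A w v → Walk A u v
here       ++ʷ q = q
step e p ++ʷ q = step e (p ++ʷ q)

Walk-bind : (∀ {a b} → Edge A a b → Walk B a b) → Walk A u w → Walk B u w
Walk-bind f here       = here
Walk-bind f (step e p) = f e ++ʷ Walk-bind f p

Walk-map : (∀ {a b} → Edge A a b → Edge B a b) → Walk A u w → Walk B u w
Walk-map f = Walk-bind λ e → step (f e) here

Walk-firstEdge : Walk A u w → u ≢ w → ∃ (Edge A u)
Walk-firstEdge here       u≢u = ⊥-elim (u≢u refl)
Walk-firstEdge (step e _) _   = _ , e

Walk-bypass : (v : Fin n) →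
  (∀ {a b} → a ≢ v → b ≢ v → Edge A a b → Edge B a b) →
  (∀ {a b} → Edge A a v → Edge A v b → a ≡ b ⊎ Edge B a b) →
  ¬ Edge A v v → Walk A u w → u ≢ v → w ≢ v → Walk B u w
Walk-bypass v off detour ¬loop here _ _ = here
Walk-bypass v off detour ¬loop (step {w = a} e p) u≢v w≢v with a ≟ v
... | no a≢v = step (off u≢v a≢v e) (Walk-bypass v off detour ¬loop p a≢v w≢v)
Walk-bypass v off detour ¬loop (step e here) u≢v w≢v | yes refl = ⊥-elim (w≢v refl)
Walk-bypass v off detour ¬loop (step e (step {w = b} e′ p)) u≢v w≢v | yes refl with b ≟ v
... | yes refl = ⊥-elim (¬loop e′)
... | no b≢v with detour e e′
...   | inj₁ refl = Walk-bypass v off detour ¬loop p b≢v w≢v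
...   | inj₂ f    = step f (Walk-bypass v off detour ¬loop p b≢v w≢v)

Cycle : Adj n → Fin n → List (Fin n) → Set
Cycle A v ws = 2 ≤ length ws × Unique (v ∷ ws) × Chain A (v ∷ ws) × Edge A (lastOr v ws) v

lastOr-∷ʳ : ∀ (w : Fin n) rest v → lastOr w (rest ++ v ∷ []) ≡ v
lastOr-∷ʳ w []         v = refl
lastOr-∷ʳ w (r ∷ rest) v = lastOr-∷ʳ r rest v

lastOr-∈ : ∀ (w : Fin n) rest → lastOr w rest ∈ w ∷ rest
lastOr-∈ w []         = here refl
lastOr-∈ w (r ∷ rest) = there (lastOr-∈ r rest)

All-lastOr : ∀ {P : Fin n → Set} w rest → All P (w ∷ rest) → P (lastOr w rest)
All-lastOr w rest ps = All.lookup ps (lastOr-∈ w rest)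

lastOr-split : ∀ (w : Fin n) rest → ∃ λ p → w ∷ rest ≡ p ++ lastOr w rest ∷ []
lastOr-split w []         = [] , refl
lastOr-split w (r ∷ rest) with lastOr-split r rest
... | p , eq = w ∷ p , cong (w ∷_) eq

length-∷ʳ : ∀ (rest : List (Fin n)) v → length (rest ++ v ∷ []) ≡ suc (length rest)
length-∷ʳ []         v = refl
length-∷ʳ (r ∷ rest) v = cong suc (length-∷ʳ rest v)

Chain-∷ʳ : ∀ w rest v → Chain A (w ∷ rest) → Edge A (lastOr w rest) v → Chain A (w ∷ rest ++ v ∷ [])
Chain-∷ʳ w []         v _         e = e , tt
Chain-∷ʳ w (r ∷ rest) v (e₀ , ch) e = e₀ , Chain-∷ʳ r rest v ch e

Chain-map : (P : Fin n → Set) → (∀ {a b} → P a → P b → Edge A a b → Edge B a b) →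
  ∀ u ws → All P (u ∷ ws) → Chain A (u ∷ ws) → Chain B (u ∷ ws)
Chain-map P f u []       _               _        = tt
Chain-map P f u (w ∷ ws) (pu ∷ pw ∷ pws) (e , ch) = f pu pw e , Chain-map P f w ws (pw ∷ pws) ch

Unique-rotate : ∀ (v : Fin n) xs → Unique (v ∷ xs) → Unique (xs ++ v ∷ [])
Unique-rotate v []       _ = [] ∷ []
Unique-rotate v (x ∷ xs) ((v≢x ∷ v∉xs) ∷ (x∉xs ∷ uxs)) =
  ++⁺ x∉xs ((v≢x ∘ sym) ∷ []) ∷ Unique-rotate v xs (v∉xs ∷ uxs)

Cycle-rotate : ∀ v w rest → Cycle A v (w ∷ rest) → Cycle A w (rest ++ v ∷ [])
Cycle-rotate {A = A} v w rest (len , uniq , (e₀ , ch) , closing) =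
  subst (2 ≤_) (sym (length-∷ʳ rest v)) len ,
  Unique-rotate v (w ∷ rest) uniq ,
  Chain-∷ʳ w rest v ch closing ,
  subst (λ z → Edge A z w) (sym (lastOr-∷ʳ w rest v)) e₀

Cycle-rotateTo : ∀ v u p s → Cycle A v (p ++ u ∷ s) → Cycle A u (s ++ v ∷ p)
Cycle-rotateTo v u []      s cyc = Cycle-rotate v u s cyc
Cycle-rotateTo {A = A} v u (w ∷ p) s cyc =
  subst (Cycle A u) (++-assoc s (v ∷ []) (w ∷ p))
    (Cycle-rotateTo w u p (s ++ v ∷ [])
      (subst (Cycle A w) (++-assoc p (u ∷ s) (v ∷ [])) (Cycle-rotate v w (p ++ u ∷ s) cyc)))

Cycle-startAt : ∀ {ws} → Cycle A v ws → u ∈ v ∷ ws → ∃ (Cycle A u)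
Cycle-startAt {ws = ws} cyc (here refl) = ws , cyc
Cycle-startAt {v = v} {u = u} cyc (there u∈ws) with ∈-∃++ u∈ws
... | p , s , refl = s ++ v ∷ p , Cycle-rotateTo v u p s cyc

Cycle-ends : ∀ {ws} → Cycle A v ws → ∃₂ λ w₁ w₂ → Edge A v w₁ × Edge A w₂ v × w₁ ≢ w₂
Cycle-ends {ws = w₁ ∷ w₂ ∷ r} (_ , (_ ∷ (w₁∉ ∷ _)) , (e₀ , _) , closing) =
  w₁ , lastOr w₂ r , e₀ , closing , All-lastOr w₂ r w₁∉
Cycle-ends {ws = _ ∷ []} (s≤s () , _)

Cycle-map : (P : Fin n → Set) → (∀ {a b} → P a → P b → Edge A a b → Edge B a b) →
  ∀ {ws} → All P (v ∷ ws) → Cycle A v ws → Cycle B v ws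
Cycle-map {v = v} P f {ws} ps (len , uniq , ch , closing) =
  len , uniq , Chain-map P f v ws ps ch , f (All-lastOr v ws ps) (All.lookup ps (here refl)) closing

Cycle-all : (P : Fin n → Set) → (∀ {a b} → Edge A a b → P a) → ∀ {ws} → Cycle A v ws → All P (v ∷ ws)
Cycle-all {A = A} {v = v} P f {ws} (_ , _ , ch , closing) = go v ws ch (f closing)
  where
  go : ∀ u ws → Chain A (u ∷ ws) → P (lastOr u ws) → All P (u ∷ ws)
  go u []       _        pl = pl ∷ []
  go u (w ∷ ws) (e , ch) pl = f e ∷ go w ws ch pl

Acyclic-mono : (∀ {a b} → Edge A a b → Edge B a b) → Acyclic B → Acyclic A
Acyclic-mono f acyclicB (u , ws , cyc) =
  acyclicB (u , ws , Cycle-map (λ _ → ⊤) (λ _ _ → f) (All.universal (λ _ → tt) (u ∷ ws)) cyc)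

Acyclic-byVertex : (v : Fin n) → (∀ {a b} → v ≢ a → v ≢ b → Edge A a b → Edge B a b) →
  (∀ ws → ¬ Cycle A v ws) → Acyclic B → Acyclic A
Acyclic-byVertex v off noCycleAtV acyclicB (u , ws , cyc) with any? (v ≟_) (u ∷ ws)
... | no v∉  = acyclicB (u , ws , Cycle-map (v ≢_) off (¬Any⇒All¬ _ v∉) cyc)
... | yes v∈ = let ws′ , cyc′ = Cycle-startAt cyc v∈ in noCycleAtV ws′ cyc′

-- Spanning trees of induced subgraphs, and the two surgeries at a new vertex

record IsTreeOn (G : Adj n) (S : Pred (Fin n) 0ℓ) (T : Adj n) : Set where
  field
    edge⊆      : Edge T a b → Edge G a b × S a × S b
    undirected : Undirected T
    loopless   : Loopless T
    connected  : S a → S b → Walk T a b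
    acyclic    : Acyclic T

IsTreeOn-isolated : {G : Adj n} {S : Pred (Fin n) 0ℓ} → ¬ S v → IsTreeOn G S T → Isolated T v
IsTreeOn-isolated v∉S tree _ e = v∉S (proj₁ (proj₂ (IsTreeOn.edge⊆ tree e)))

IsTreeOn-resp : {G : Adj n} {S S′ : Pred (Fin n) 0ℓ} → S ≐ S′ → IsTreeOn G S T → IsTreeOn G S′ T
IsTreeOn-resp (S⊆S′ , S′⊆S) tree = record
  { edge⊆      = λ e → let g , a∈S , b∈S = edge⊆ e in g , S⊆S′ a∈S , S⊆S′ b∈S
  ; undirected = undirected
  ; loopless   = loopless
  ; connected  = λ a∈S′ b∈S′ → connected (S′⊆S a∈S′) (S′⊆S b∈S′)
  ; acyclic    = acyclic
  }
  where open IsTreeOn tree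

IsTreeOn⇒IsSpanningTree : {G : Adj n} {S : Pred (Fin n) 0ℓ} → (∀ w → S w) → IsTreeOn G S T → IsSpanningTree G T
IsTreeOn⇒IsSpanningTree all tree =
  (λ _ _ → proj₁ ∘ edge⊆) , (adj-comm undirected , adj-loop loopless) , (λ a b → connected (all a) (all b)) , acyclic
  where open IsTreeOn tree

IsSpanningTree⇒IsTreeOn : {G : Adj n} {S : Pred (Fin n) 0ℓ} → (∀ w → S w) → IsSpanningTree G T → IsTreeOn G S T
IsSpanningTree⇒IsTreeOn all (sub , (comm , loop) , connected , acyclic) = record
  { edge⊆      = λ {a} {b} e → sub a b e , all a , all b
  ; undirected = mkUndirected comm
  ; loopless   = mkLoopless loop
  ; connected  = λ {a} {b} _ _ → connected a b
  ; acyclic    = acyclic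
  }

subdivide : Fin n → Fin n → Fin n → Adj n → Adj n
subdivide v x y T = addEdge v y (addEdge v x (removeEdge x y T))

subdivide⁻ : ∀ v x y (T : Adj n) → Edge (subdivide v x y T) a b →
  SamePair v x a b ⊎ SamePair v y a b ⊎ (¬ SamePair x y a b × Edge T a b)
subdivide⁻ v x y T e with addEdge⁻ v y (addEdge v x (removeEdge x y T)) e
... | inj₁ p  = inj₂ (inj₁ p)
... | inj₂ e₁ with addEdge⁻ v x (removeEdge x y T) e₁
...   | inj₁ p  = inj₁ p
...   | inj₂ e₂ = inj₂ (inj₂ (removeEdge⁻ x y T e₂))

subdivide-newˣ : ∀ v x y (T : Adj n) → SamePair v x a b → Edge (subdivide v x y T) a b
subdivide-newˣ v x y T p = addEdge-keep v y (addEdge v x (removeEdge x y T)) (addEdge-new v x (removeEdge x y T) p)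

subdivide-newʸ : ∀ v x y (T : Adj n) → SamePair v y a b → Edge (subdivide v x y T) a b
subdivide-newʸ v x y T p = addEdge-new v y (addEdge v x (removeEdge x y T)) p

subdivide-keep : ∀ v x y (T : Adj n) → ¬ SamePair x y a b → Edge T a b → Edge (subdivide v x y T) a b
subdivide-keep v x y T ¬p e =
  addEdge-keep v y (addEdge v x (removeEdge x y T)) (addEdge-keep v x (removeEdge x y T) (removeEdge-keep x y T ¬p e))

module _ {G : Adj n} (undG : Undirected G) {S : Pred (Fin n) 0ℓ} {v : Fin n} (v∉S : ¬ S v) where

  private
    ∪-other : (S ∪ ｛ v ｝) a → v ≢ a → S a
    ∪-other (inj₁ a∈S) _   = a∈S
    ∪-other (inj₂ v≡a) v≢a = ⊥-elim (v≢a v≡a)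

    ∈S⇒≢ : S a → v ≢ a
    ∈S⇒≢ a∈S refl = v∉S a∈S

    ∈S⇒≢′ : S a → a ≢ v
    ∈S⇒≢′ a∈S refl = v∉S a∈S

    spoke⊆ : S w → Edge G v w → SamePair v w a b → Edge G a b × (S ∪ ｛ v ｝) a × (S ∪ ｛ v ｝) b
    spoke⊆ w∈S g (inj₁ (refl , refl)) = g , inj₂ refl , inj₁ w∈S
    spoke⊆ w∈S g (inj₂ (refl , refl)) = Edge-flip undG g , inj₁ w∈S , inj₂ refl

    old⊆ : Edge G a b × S a × S b → Edge G a b × (S ∪ ｛ v ｝) a × (S ∪ ｛ v ｝) b
    old⊆ (g , a∈S , b∈S) = g , inj₁ a∈S , inj₁ b∈S

    connected-∪ : Undirected T → S z → Edge T v z → (∀ {a b} → S a → S b → Walk T a b) →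
      (S ∪ ｛ v ｝) a → (S ∪ ｛ v ｝) b → Walk T a b
    connected-∪ und z∈S evz conn (inj₂ refl) (inj₂ refl) = here
    connected-∪ und z∈S evz conn (inj₂ refl) (inj₁ b∈S)  = step evz (conn z∈S b∈S)
    connected-∪ und z∈S evz conn (inj₁ a∈S)  (inj₂ refl) = conn a∈S z∈S ++ʷ step (Edge-flip und evz) here
    connected-∪ und z∈S evz conn (inj₁ a∈S)  (inj₁ b∈S)  = conn a∈S b∈S

  module _ {z : Fin n} (z∈S : S z) (Gvz : Edge G v z) where

    private
      v≢z : v ≢ z
      v≢z = ∈S⇒≢ z∈S

      addLeaf-off : ∀ T → v ≢ a → v ≢ b → Edge (addEdge v z T) a b → Edge T a b
      addLeaf-off T v≢a v≢b e with addEdge⁻ v z T e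
      ... | inj₁ (inj₁ (a≡v , _)) = ⊥-elim (v≢a (sym a≡v))
      ... | inj₁ (inj₂ (_ , b≡v)) = ⊥-elim (v≢b (sym b≡v))
      ... | inj₂ e′               = e′

    addLeaf-isTreeOn : IsTreeOn G S T → IsTreeOn G (S ∪ ｛ v ｝) (addEdge v z T)
    addLeaf-isTreeOn {T = T} tree = record
      { edge⊆      = edge⊆′
      ; undirected = und′
      ; loopless   = addEdge-loopless v≢z loopless
      ; connected  = connected-∪ und′ z∈S (addEdge-new v z T (inj₁ (refl , refl)))
                       (λ a∈S b∈S → Walk-map (addEdge-keep v z T) (connected a∈S b∈S))
      ; acyclic    = Acyclic-byVertex v (addLeaf-off T) noCycleAtV acyclic
      }
      where
      open IsTreeOn tree
      und′ : Undirected (addEdge v z T)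
      und′ = setEdge-undirected true v z undirected
      edge⊆′ : Edge (addEdge v z T) a b → Edge G a b × (S ∪ ｛ v ｝) a × (S ∪ ｛ v ｝) b
      edge⊆′ e = [ spoke⊆ z∈S Gvz , old⊆ ∘ edge⊆ ]′ (addEdge⁻ v z T e)
      noCycleAtV : ∀ ws → ¬ Cycle (addEdge v z T) v ws
      noCycleAtV ws cyc = let _ , _ , e₁ , e₂ , w₁≢w₂ = Cycle-ends cyc in
        w₁≢w₂ (trans (leaf e₁) (sym (leaf (Edge-flip und′ e₂))))
        where
        leaf : Edge (addEdge v z T) v w → w ≡ z
        leaf = addEdge-neighbour T v≢z (IsTreeOn-isolated v∉S tree)

    removeLeaf-isTreeOn : Undirected T → Loopless T → Isolated T v →
      IsTreeOn G (S ∪ ｛ v ｝) (addEdge v z T) → IsTreeOn G S T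
    removeLeaf-isTreeOn {T = T} und loopless isolated tree′ = record
      { edge⊆      = edge⊆
      ; undirected = und
      ; loopless   = loopless
      ; connected  = λ a∈S b∈S → Walk-bypass v off detour (Loopless⇒¬Edge loopless′)
                       (connected′ (inj₁ a∈S) (inj₁ b∈S)) (∈S⇒≢′ a∈S) (∈S⇒≢′ b∈S)
      ; acyclic    = Acyclic-mono (addEdge-keep v z T) acyclic′
      }
      where
      open IsTreeOn tree′ renaming (edge⊆ to edge⊆′; undirected to und′; loopless to loopless′;
                                    connected to connected′; acyclic to acyclic′)
      edge⊆ : Edge T a b → Edge G a b × S a × S b
      edge⊆ e = let g , a∈ , b∈ = edge⊆′ (addEdge-keep v z T e) in
        g , ∪-other a∈ (Isolated⇒≢ T isolated e) , ∪-other b∈ (Isolated⇒≢ T isolated (Edge-flip und e))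
      off : a ≢ v → b ≢ v → Edge (addEdge v z T) a b → Edge T a b
      off a≢v b≢v = addLeaf-off T (a≢v ∘ sym) (b≢v ∘ sym)
      detour : Edge (addEdge v z T) a v → Edge (addEdge v z T) v b → a ≡ b ⊎ Edge T a b
      detour e e′ = inj₁ (trans (addEdge-neighbour T v≢z isolated (Edge-flip und′ e))
                                (sym (addEdge-neighbour T v≢z isolated e′)))

  module _ {x y : Fin n} (x∈S : S x) (y∈S : S y) (x≢y : x ≢ y) (Gvx : Edge G v x) (Gvy : Edge G v y) where

    private
      v≢x : v ≢ x
      v≢x = ∈S⇒≢ x∈S

      v≢y : v ≢ y
      v≢y = ∈S⇒≢ y∈S

      subdivide-neighbour : ∀ T → Isolated T v → Edge (subdivide v x y T) v w → w ≡ x ⊎ w ≡ y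
      subdivide-neighbour T isolated e with subdivide⁻ v x y T e
      ... | inj₁ (inj₁ (_ , w≡x))        = inj₁ w≡x
      ... | inj₁ (inj₂ (v≡x , _))        = ⊥-elim (v≢x v≡x)
      ... | inj₂ (inj₁ (inj₁ (_ , w≡y))) = inj₂ w≡y
      ... | inj₂ (inj₁ (inj₂ (v≡y , _))) = ⊥-elim (v≢y v≡y)
      ... | inj₂ (inj₂ (_ , e′))         = ⊥-elim (isolated _ e′)

      subdivide-off : ∀ T → v ≢ a → v ≢ b → Edge (subdivide v x y T) a b → ¬ SamePair x y a b × Edge T a b
      subdivide-off T v≢a v≢b e with subdivide⁻ v x y T e
      ... | inj₁ p           = ⊥-elim ([ v≢a , v≢b ]′ (SamePair⇒∋ p))
      ... | inj₂ (inj₁ p)    = ⊥-elim ([ v≢a , v≢b ]′ (SamePair⇒∋ p))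
      ... | inj₂ (inj₂ ¬p×e) = ¬p×e

      spoke : ∀ T → w ≡ x ⊎ w ≡ y → Edge (subdivide v x y T) v w
      spoke T (inj₁ refl) = subdivide-newˣ v x y T (inj₁ (refl , refl))
      spoke T (inj₂ refl) = subdivide-newʸ v x y T (inj₁ (refl , refl))

    subdivide-isTreeOn : IsTreeOn G S T → Edge T x y → IsTreeOn G (S ∪ ｛ v ｝) (subdivide v x y T)
    subdivide-isTreeOn {T = T} tree exy = record
      { edge⊆      = edge⊆′
      ; undirected = und′
      ; loopless   = addEdge-loopless v≢y (addEdge-loopless v≢x (removeEdge-loopless x y loopless))
      ; connected  = connected-∪ und′ x∈S (spoke T (inj₁ refl)) (λ a∈S b∈S → Walk-bind detour (connected a∈S b∈S))
      ; acyclic    = Acyclic-byVertex v (λ v≢a v≢b → proj₂ ∘ subdivide-off T v≢a v≢b) noCycleAtV acyclic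
      }
      where
      open IsTreeOn tree
      T′ : Adj n
      T′ = subdivide v x y T
      und′ : Undirected T′
      und′ = setEdge-undirected true v y (setEdge-undirected true v x (setEdge-undirected false x y undirected))
      edge⊆′ : Edge T′ a b → Edge G a b × (S ∪ ｛ v ｝) a × (S ∪ ｛ v ｝) b
      edge⊆′ e = [ spoke⊆ x∈S Gvx , [ spoke⊆ y∈S Gvy , old⊆ ∘ edge⊆ ∘ proj₂ ]′ ]′ (subdivide⁻ v x y T e)
      detour : Edge T a b → Walk T′ a b
      detour {a} {b} e with samePair? x y a b
      ... | no ¬p                    = step (subdivide-keep v x y T ¬p e) here
      ... | yes (inj₁ (refl , refl)) = step (Edge-flip und′ (spoke T (inj₁ refl))) (step (spoke T (inj₂ refl)) here)
      ... | yes (inj₂ (refl , refl)) = step (Edge-flip und′ (spoke T (inj₂ refl))) (step (spoke T (inj₁ refl)) here)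
      ends : ∀ {w₁ w₂ r} → Cycle T′ v (w₁ ∷ w₂ ∷ r) → SamePair x y w₁ (lastOr w₂ r)
      ends {w₂ = w₂} {r} (_ , (_ ∷ w₁∉ ∷ _) , (e₁ , _) , closing) =
        SamePair-fromDistinct (subdivide-neighbour T (IsTreeOn-isolated v∉S tree) e₁)
          (subdivide-neighbour T (IsTreeOn-isolated v∉S tree) (Edge-flip und′ closing)) (All-lastOr w₂ r w₁∉)
      -- The two neighbours of v on the cycle are x and y, so the rest of the cycle closes up in T through xy.
      noCycleAtV : ∀ ws → ¬ Cycle T′ v ws
      noCycleAtV (_ ∷ []) (s≤s () , _)
      noCycleAtV (w₁ ∷ w₂ ∷ []) cyc@(_ , (v∉ ∷ _) , (_ , e₁₂ , _) , _) =
        proj₁ (subdivide-off T (All.lookup v∉ (here refl)) (All.lookup v∉ (there (here refl))) e₁₂) (ends cyc)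
      noCycleAtV (w₁ ∷ w₂ ∷ r₀ ∷ r) cyc@(_ , (v∉ ∷ uniq) , (_ , ch) , _) =
        acyclic (w₁ , w₂ ∷ r₀ ∷ r , s≤s (s≤s z≤n) , uniq ,
                 Chain-map (v ≢_) (λ v≢a v≢b → proj₂ ∘ subdivide-off T v≢a v≢b) w₁ (w₂ ∷ r₀ ∷ r) v∉ ch ,
                 Edge-SamePair undirected (SamePair-swapʳ (ends cyc)) exy)

    unsubdivide-isTreeOn : Edge G x y → Undirected T → Loopless T → Isolated T v → Edge T x y →
      IsTreeOn G (S ∪ ｛ v ｝) (subdivide v x y T) → IsTreeOn G S T
    unsubdivide-isTreeOn {T = T} Gxy und loopless isolated exy tree′ = record
      { edge⊆      = edge⊆
      ; undirected = und
      ; loopless   = loopless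
      ; connected  = λ a∈S b∈S → Walk-bypass v off detour (Loopless⇒¬Edge loopless′)
                       (connected′ (inj₁ a∈S) (inj₁ b∈S)) (∈S⇒≢′ a∈S) (∈S⇒≢′ b∈S)
      ; acyclic    = Acyclic-byVertex x offˣ noCycleAtX acyclic′
      }
      where
      open IsTreeOn tree′ renaming (edge⊆ to edge⊆′; undirected to und′; loopless to loopless′;
                                    connected to connected′; acyclic to acyclic′)
      T′ : Adj n
      T′ = subdivide v x y T
      edge⊆ : Edge T a b → Edge G a b × S a × S b
      edge⊆ {a} {b} e with samePair? x y a b
      ... | yes (inj₁ (refl , refl)) = Gxy , x∈S , y∈S
      ... | yes (inj₂ (refl , refl)) = Edge-flip undG Gxy , y∈S , x∈S
      ... | no ¬p = let g , a∈ , b∈ = edge⊆′ (subdivide-keep v x y T ¬p e) in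
        g , ∪-other a∈ (Isolated⇒≢ T isolated e) , ∪-other b∈ (Isolated⇒≢ T isolated (Edge-flip und e))
      off : a ≢ v → b ≢ v → Edge T′ a b → Edge T a b
      off a≢v b≢v = proj₂ ∘ subdivide-off T (a≢v ∘ sym) (b≢v ∘ sym)
      detour : Edge T′ a v → Edge T′ v b → a ≡ b ⊎ Edge T a b
      detour {a} {b} e e′ with a ≟ b
      ... | yes a≡b = inj₁ a≡b
      ... | no a≢b  = inj₂ (Edge-SamePair und (SamePair-fromDistinct (subdivide-neighbour T isolated (Edge-flip und′ e))
                                                                    (subdivide-neighbour T isolated e′) a≢b) exy)
      offˣ : x ≢ a → x ≢ b → Edge T a b → Edge T′ a b
      offˣ x≢a x≢b = subdivide-keep v x y T ([ x≢a , x≢b ]′ ∘ SamePair⇒∋)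
      -- A cycle of T through the edge pq = xy becomes a cycle of T′ by replacing that edge with p v q.
      detourCycle : ∀ {p q r} → SamePair x y p q → Cycle T p (q ∷ r) → HasCycle T′
      detourCycle {r = []} _ (s≤s () , _)
      detourCycle {p} {q} {r₀ ∷ r} pq cyc@(_ , (p∉ ∷ uniq@(q∉ ∷ _)) , (_ , ch) , closing) =
        v , q ∷ r₀ ∷ r ++ p ∷ [] , s≤s (s≤s z≤n) ,
        (++⁺ (All.tail v∉) (All.head v∉ ∷ []) ∷ Unique-rotate p (q ∷ r₀ ∷ r) (p∉ ∷ uniq)) ,
        (spoke T (SamePair⇒∈ (SamePair-swapʳ pq)) ,
         Chain-∷ʳ q (r₀ ∷ r) p (Chain-map (p ≢_) keep q (r₀ ∷ r) p∉ ch) closing′) ,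
        subst (λ l → Edge T′ l v) (sym (lastOr-∷ʳ q (r₀ ∷ r) p)) (Edge-flip und′ (spoke T (SamePair⇒∈ pq)))
        where
        v∉ : All (v ≢_) (p ∷ q ∷ r₀ ∷ r)
        v∉ = Cycle-all (v ≢_) (Isolated⇒≢ T isolated) cyc
        keep : p ≢ a → p ≢ b → Edge T a b → Edge T′ a b
        keep p≢a p≢b = subdivide-keep v x y T (λ ab → [ p≢a , p≢b ]′ (SamePair-covers ab (SamePair⇒∈ pq)))
        closing′ : Edge T′ (lastOr r₀ r) p
        closing′ = subdivide-keep v x y T (λ lp → All-lastOr r₀ r q∉ (sym (SamePair-other x≢y pq lp))) closing
      noCycleAtX : ∀ ws → ¬ Cycle T x ws
      noCycleAtX (_ ∷ []) (s≤s () , _)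
      noCycleAtX (w₁ ∷ w₂ ∷ r) cyc@(len , (x∉ ∷ uniq) , (e₁ , ch) , closing) with w₁ ≟ y | lastOr w₂ r ≟ y
      ... | yes refl | _ = acyclic′ (detourCycle (inj₁ (refl , refl)) cyc)
      ... | no _ | yes l≡y =
        let p , ws≡ = lastOr-split w₁ (w₂ ∷ r) in
        acyclic′ (detourCycle (inj₂ (refl , refl))
                   (Cycle-rotateTo x y p [] (subst (Cycle T x) (trans ws≡ (cong (λ l → p ++ l ∷ []) l≡y)) cyc)))
      ... | no w₁≢y | no l≢y =
        acyclic′ (x , w₁ ∷ w₂ ∷ r , len , x∉ ∷ uniq ,
                  (subdivide-keep v x y T (λ { (inj₁ (_ , w₁≡y)) → w₁≢y w₁≡y ; (inj₂ (x≡y , _)) → x≢y x≡y }) e₁ ,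
                   Chain-map (x ≢_) offˣ w₁ (w₂ ∷ r) x∉ ch) ,
                  subdivide-keep v x y T (λ { (inj₁ (_ , x≡y)) → x≢y x≡y ; (inj₂ (l≡y , _)) → l≢y l≡y }) closing)

-- One step of the algorithm

detach : Fin n → Fin n → Fin n → Adj n → Adj n
detach v x y M = removeEdge v y (removeEdge v x M)

detach⁻ : ∀ v x y (M : Adj n) → Edge (detach v x y M) a b → ¬ SamePair v x a b × ¬ SamePair v y a b × Edge M a b
detach⁻ v x y M e = let ¬py , e′ = removeEdge⁻ v y (removeEdge v x M) e
                        ¬px , e″ = removeEdge⁻ v x M e′
                    in ¬px , ¬py , e″

detach-keep : ∀ v x y (M : Adj n) → ¬ SamePair v x a b → ¬ SamePair v y a b → Edge M a b → Edge (detach v x y M) a b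
detach-keep v x y M ¬px ¬py e = removeEdge-keep v y (removeEdge v x M) ¬py (removeEdge-keep v x M ¬px e)

contract : Fin n → Fin n → Fin n → Adj n → Adj n
contract v x y M = if adj M v x ∧ adj M v y then addEdge x y (detach v x y M) else detach v x y M

contract-leaf : ¬ Edge M v x ⊎ ¬ Edge M v y → contract v x y M ≡ detach v x y M
contract-leaf {M = M} {v} {x} {y} (inj₁ ¬vx) rewrite ¬-not ¬vx = refl
contract-leaf {M = M} {v} {x} {y} (inj₂ ¬vy) rewrite ¬-not ¬vy | ∧-zeroʳ (adj M v x) = refl

contract-subdivided : Edge M v x → Edge M v y → contract v x y M ≡ addEdge x y (detach v x y M)
contract-subdivided evx evy rewrite evx | evy = refl

detach-addEdge : Undirected T → Isolated T v → w ≡ x ⊎ w ≡ y → detach v x y (addEdge v w T) ≡ T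
detach-addEdge {T = T} {v} {w} {x} {y} und isolated w∈ = Edge-ext to from
  where
  to : Edge (detach v x y (addEdge v w T)) a b → Edge T a b
  to e = let ¬px , ¬py , e′ = detach⁻ v x y (addEdge v w T) e in
    [ (λ p → ⊥-elim ([ (λ { refl → ¬px p }) , (λ { refl → ¬py p }) ]′ w∈)) , id ]′ (addEdge⁻ v w T e′)
  from : Edge T a b → Edge (detach v x y (addEdge v w T)) a b
  from e = detach-keep v x y (addEdge v w T) (Isolated⇒¬SamePair und isolated e)
             (Isolated⇒¬SamePair und isolated e) (addEdge-keep v w T e)

addEdge-detach-subdivide : Undirected T → Isolated T v → Edge T x y →
  addEdge x y (detach v x y (subdivide v x y T)) ≡ T
addEdge-detach-subdivide {T = T} {v} {x} {y} und isolated exy = Edge-ext to from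
  where
  T′ : Adj _
  T′ = subdivide v x y T
  to : Edge (addEdge x y (detach v x y T′)) a b → Edge T a b
  to e = [ (λ p → Edge-SamePair und p exy) , from-detached ]′ (addEdge⁻ x y (detach v x y T′) e)
    where
    from-detached : Edge (detach v x y T′) a b → Edge T a b
    from-detached e′ = let ¬px , ¬py , e″ = detach⁻ v x y T′ e′ in
      [ ⊥-elim ∘ ¬px , [ ⊥-elim ∘ ¬py , proj₂ ]′ ]′ (subdivide⁻ v x y T e″)
  from : Edge T a b → Edge (addEdge x y (detach v x y T′)) a b
  from {a} {b} e = cases (samePair? x y a b)
    where
    cases : Dec (SamePair x y a b) → Edge (addEdge x y (detach v x y T′)) a b
    cases (yes p) = addEdge-new x y (detach v x y T′) p
    cases (no ¬p) = addEdge-keep x y (detach v x y T′)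
                      (detach-keep v x y T′ (Isolated⇒¬SamePair und isolated e) (Isolated⇒¬SamePair und isolated e)
                        (subdivide-keep v x y T ¬p e))

addEdge-detach : Undirected M → (∀ {w} → Edge M v w → w ≡ z) → Edge M v z → M ≡ addEdge v z (detach v x y M)
addEdge-detach {M = M} {v} {z} {x} {y} und onlyZ evz = Edge-ext to from
  where
  toward-z : Edge M a b → SamePair v w a b → SamePair v z a b
  toward-z e p = subst (λ t → SamePair v t _ _) (onlyZ (Edge-SamePair und (SamePair-sym p) e)) p
  to : Edge M a b → Edge (addEdge v z (detach v x y M)) a b
  to {a} {b} e = cases (samePair? v z a b)
    where
    cases : Dec (SamePair v z a b) → Edge (addEdge v z (detach v x y M)) a b
    cases (yes p) = addEdge-new v z (detach v x y M) p
    cases (no ¬p) = addEdge-keep v z (detach v x y M) (detach-keep v x y M (¬p ∘ toward-z e) (¬p ∘ toward-z e) e)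
  from : Edge (addEdge v z (detach v x y M)) a b → Edge M a b
  from e = [ (λ p → Edge-SamePair und p evz) , proj₂ ∘ proj₂ ∘ detach⁻ v x y M ]′ (addEdge⁻ v z (detach v x y M) e)

subdivide-addEdge-detach : Undirected M → Edge M v x → Edge M v y → ¬ Edge M x y →
  M ≡ subdivide v x y (addEdge x y (detach v x y M))
subdivide-addEdge-detach {M = M} {v} {x} {y} und evx evy ¬xy = Edge-ext to from
  where
  T₀ : Adj _
  T₀ = addEdge x y (detach v x y M)
  to : Edge M a b → Edge (subdivide v x y T₀) a b
  to {a} {b} e = cases (samePair? v x a b) (samePair? v y a b)
    where
    cases : Dec (SamePair v x a b) → Dec (SamePair v y a b) → Edge (subdivide v x y T₀) a b
    cases (yes p)  _        = subdivide-newˣ v x y T₀ p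
    cases (no _)   (yes p)  = subdivide-newʸ v x y T₀ p
    cases (no ¬px) (no ¬py) = subdivide-keep v x y T₀ (λ p → ¬xy (Edge-SamePair und (SamePair-sym p) e))
                                (addEdge-keep x y (detach v x y M) (detach-keep v x y M ¬px ¬py e))
  from : Edge (subdivide v x y T₀) a b → Edge M a b
  from e = [ (λ p → Edge-SamePair und p evx) , [ (λ p → Edge-SamePair und p evy) , rest ]′ ]′ (subdivide⁻ v x y T₀ e)
    where
    rest : ¬ SamePair x y a b × Edge T₀ a b → Edge M a b
    rest (¬p , e′) = [ ⊥-elim ∘ ¬p , proj₂ ∘ proj₂ ∘ detach⁻ v x y M ]′ (addEdge⁻ x y (detach v x y M) e′)

∈-extend⁻ : ∀ {T′} → T′ ∈ extend v x y T →
  T′ ≡ addEdge v x T ⊎ T′ ≡ addEdge v y T ⊎ (Edge T x y × T′ ≡ subdivide v x y T)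
∈-extend⁻ (here eq)         = inj₁ eq
∈-extend⁻ (there (here eq)) = inj₂ (inj₁ eq)
∈-extend⁻ {x = x} {y} {T} (there (there m)) with adj T x y
∈-extend⁻ (there (there (here eq))) | true = inj₂ (inj₂ (refl , eq))

subdivide∈extend : Edge T x y → subdivide v x y T ∈ extend v x y T
subdivide∈extend exy rewrite exy = there (there (here refl))

module _ {v x y : Fin n} (v≢x : v ≢ x) (v≢y : v ≢ y) (x≢y : x ≢ y) where

  contract-extend : Undirected T → Isolated T v → ∀ {T′} → T′ ∈ extend v x y T → contract v x y T′ ≡ T
  contract-extend {T = T} und isolated m = [ leafˣ , [ leafʸ , subdivision ]′ ]′ (∈-extend⁻ m)
    where
    leafˣ : ∀ {T′} → T′ ≡ addEdge v x T → contract v x y T′ ≡ T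
    leafˣ refl = trans (contract-leaf (inj₂ λ e → x≢y (sym (addEdge-neighbour T v≢x isolated e))))
                       (detach-addEdge und isolated (inj₁ refl))
    leafʸ : ∀ {T′} → T′ ≡ addEdge v y T → contract v x y T′ ≡ T
    leafʸ refl = trans (contract-leaf (inj₁ λ e → x≢y (addEdge-neighbour T v≢y isolated e)))
                       (detach-addEdge und isolated (inj₂ refl))
    subdivision : ∀ {T′} → Edge T x y × T′ ≡ subdivide v x y T → contract v x y T′ ≡ T
    subdivision (exy , refl) =
      trans (contract-subdivided (subdivide-newˣ v x y T (inj₁ (refl , refl))) (subdivide-newʸ v x y T (inj₁ (refl , refl))))
            (addEdge-detach-subdivide und isolated exy)

  extend-unique : Isolated T v → Unique (extend v x y T)
  extend-unique {T = T} isolated = unique (adj T x y)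
    where
    ¬vy₁ : ¬ Edge (addEdge v x T) v y
    ¬vy₁ e = x≢y (sym (addEdge-neighbour T v≢x isolated e))
    A₁≢A₂ : addEdge v x T ≢ addEdge v y T
    A₁≢A₂ = ≢-byEdge v y (addEdge-new v y T (inj₁ (refl , refl))) ¬vy₁
    A₁≢A₃ : addEdge v x T ≢ subdivide v x y T
    A₁≢A₃ = ≢-byEdge v y (subdivide-newʸ v x y T (inj₁ (refl , refl))) ¬vy₁
    A₂≢A₃ : addEdge v y T ≢ subdivide v x y T
    A₂≢A₃ = ≢-byEdge v x (subdivide-newˣ v x y T (inj₁ (refl , refl))) λ e → x≢y (addEdge-neighbour T v≢y isolated e)
    unique : ∀ b → Unique (addEdge v x T ∷ addEdge v y T ∷ (if b then subdivide v x y T ∷ [] else []))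
    unique true  = (A₁≢A₂ ∷ A₁≢A₃ ∷ []) ∷ (A₂≢A₃ ∷ []) ∷ [] ∷ []
    unique false = (A₁≢A₂ ∷ []) ∷ [] ∷ []

record Simplicial2On (G : Adj n) (S : Pred (Fin n) 0ℓ) (v x y : Fin n) : Set where
  field
    v∉S        : ¬ S v
    x∈S        : S x
    y∈S        : S y
    x≢y        : x ≢ y
    Gvx        : Edge G v x
    Gvy        : Edge G v y
    Gxy        : Edge G x y
    neighbours : S w → Edge G v w → w ≡ x ⊎ w ≡ y

  v≢x : v ≢ x
  v≢x refl = v∉S x∈S

  v≢y : v ≢ y
  v≢y refl = v∉S y∈S

Simplicial2On-swap : {G : Adj n} {S : Pred (Fin n) 0ℓ} → Undirected G → Simplicial2On G S v x y → Simplicial2On G S v y x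
Simplicial2On-swap undG simplicial = record
  { v∉S = v∉S ; x∈S = y∈S ; y∈S = x∈S ; x≢y = x≢y ∘ sym
  ; Gvx = Gvy ; Gvy = Gvx ; Gxy = Edge-flip undG Gxy
  ; neighbours = λ w∈S e → ⊎-swap (neighbours w∈S e)
  }
  where open Simplicial2On simplicial

record ListsTreesOn (G : Adj n) (S : Pred (Fin n) 0ℓ) (L : List (Adj n)) : Set where
  field
    sound    : T ∈ L → IsTreeOn G S T
    complete : IsTreeOn G S T → T ∈ L
    unique   : Unique L

ListsTreesOn-resp : {G : Adj n} {S S′ : Pred (Fin n) 0ℓ} {L : List (Adj n)} →
  S ≐ S′ → ListsTreesOn G S L → ListsTreesOn G S′ L
ListsTreesOn-resp S≐S′ trees = record
  { sound    = IsTreeOn-resp S≐S′ ∘ sound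
  ; complete = complete ∘ IsTreeOn-resp (×-swap S≐S′)
  ; unique   = unique
  }
  where open ListsTreesOn trees

-- The lists f x are pairwise disjoint because g recovers x from each of their entries.
concatMap-unique : ∀ {X Y : Set} (f : X → List Y) (g : Y → X) {xs} → Unique xs →
  (∀ {x} → x ∈ xs → Unique (f x)) → (∀ {x y} → x ∈ xs → y ∈ f x → g y ≡ x) → Unique (concatMap f xs)
concatMap-unique f g {[]}     _           _        _       = []
concatMap-unique f g {x ∷ xs} (x∉ ∷ uniq) unique-f retract =
  Unique.++⁺ (unique-f (here refl)) (concatMap-unique f g uniq (unique-f ∘ there) (retract ∘ there)) disjoint
  where
  disjoint : Disjoint (f x) (concatMap f xs)
  disjoint (y∈fx , y∈rest) =
    let x′ , x′∈xs , y∈fx′ = find (∈-concatMap⁻ f y∈rest) in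
    All.lookup x∉ x′∈xs (trans (sym (retract (here refl) y∈fx)) (retract (there x′∈xs) y∈fx′))

module _ {G : Adj n} (undG : Undirected G) {S : Pred (Fin n) 0ℓ} {v x y : Fin n} (simplicial : Simplicial2On G S v x y) where

  open Simplicial2On simplicial

  extend-isTreeOn : ∀ {T′} → IsTreeOn G S T → T′ ∈ extend v x y T → IsTreeOn G (S ∪ ｛ v ｝) T′
  extend-isTreeOn tree m with ∈-extend⁻ m
  ... | inj₁ refl                = addLeaf-isTreeOn undG v∉S x∈S Gvx tree
  ... | inj₂ (inj₁ refl)         = addLeaf-isTreeOn undG v∉S y∈S Gvy tree
  ... | inj₂ (inj₂ (exy , refl)) = subdivide-isTreeOn undG v∉S x∈S y∈S x≢y Gvx Gvy tree exy

  extend-complete : ∀ {T′} → IsTreeOn G (S ∪ ｛ v ｝) T′ → ∃ λ T → IsTreeOn G S T × T′ ∈ extend v x y T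
  extend-complete {T′ = T′} tree′ = cases (Edge? T′ v x) (Edge? T′ v y)
    where
    open IsTreeOn tree′
    neighbour : Edge T′ v w → w ≡ x ⊎ w ≡ y
    neighbour e with edge⊆ e
    ... | g , _ , inj₁ w∈S  = neighbours w∈S g
    ... | _ , _ , inj₂ refl = ⊥-elim (Loopless⇒¬Edge loopless e)
    T₀ : Adj n
    T₀ = detach v x y T′
    und₀ : Undirected T₀
    und₀ = setEdge-undirected false v y (setEdge-undirected false v x undirected)
    loopless₀ : Loopless T₀
    loopless₀ = removeEdge-loopless v y (removeEdge-loopless v x loopless)
    isolated₀ : Isolated T₀ v
    isolated₀ _ e = let ¬px , ¬py , e′ = detach⁻ v x y T′ e in
      [ (λ { refl → ¬px (inj₁ (refl , refl)) }) , (λ { refl → ¬py (inj₁ (refl , refl)) }) ]′ (neighbour e′)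
    leaf : S z → Edge G v z → Edge T′ v z → (∀ {w} → Edge T′ v w → w ≡ z) →
      ∃ λ T → IsTreeOn G S T × T′ ≡ addEdge v z T
    leaf {z = z} z∈S Gvz evz onlyZ =
      T₀ , removeLeaf-isTreeOn undG v∉S z∈S Gvz und₀ loopless₀ isolated₀ (subst (IsTreeOn G (S ∪ ｛ v ｝)) eq tree′) ,
      eq
      where
      eq : T′ ≡ addEdge v z T₀
      eq = addEdge-detach undirected onlyZ evz
    subdivided : Edge T′ v x → Edge T′ v y → ∃ λ T → IsTreeOn G S T × T′ ≡ subdivide v x y T × Edge T x y
    subdivided vx vy = T₁ , unsubdivide-isTreeOn undG v∉S x∈S y∈S x≢y Gvx Gvy Gxy und₁ loopless₁ isolated₁ exy₁
                              (subst (IsTreeOn G (S ∪ ｛ v ｝)) eq tree′) , eq , exy₁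
      where
      T₁ : Adj n
      T₁ = addEdge x y T₀
      und₁ : Undirected T₁
      und₁ = setEdge-undirected true x y und₀
      loopless₁ : Loopless T₁
      loopless₁ = addEdge-loopless x≢y loopless₀
      isolated₁ : Isolated T₁ v
      isolated₁ b e = [ [ v≢x , v≢y ]′ ∘ SamePair⇒∈ , isolated₀ b ]′ (addEdge⁻ x y T₀ e)
      exy₁ : Edge T₁ x y
      exy₁ = addEdge-new x y T₀ (inj₁ (refl , refl))
      -- v x y would be a triangle.
      ¬xy : ¬ Edge T′ x y
      ¬xy exy = acyclic (v , x ∷ y ∷ [] , s≤s (s≤s z≤n) , ((v≢x ∷ v≢y ∷ []) ∷ (x≢y ∷ []) ∷ [] ∷ []) ,
                         (vx , exy , tt) , Edge-flip undirected vy)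
      eq : T′ ≡ subdivide v x y T₁
      eq = subdivide-addEdge-detach undirected vx vy ¬xy
    cases : Dec (Edge T′ v x) → Dec (Edge T′ v y) → ∃ λ T → IsTreeOn G S T × T′ ∈ extend v x y T
    cases (yes vx) (no ¬vy) =
      let T , tree , eq = leaf x∈S Gvx vx (λ e → [ id , (λ { refl → ⊥-elim (¬vy e) }) ]′ (neighbour e)) in
      T , tree , here eq
    cases (no ¬vx) (yes vy) =
      let T , tree , eq = leaf y∈S Gvy vy (λ e → [ (λ { refl → ⊥-elim (¬vx e) }) , id ]′ (neighbour e)) in
      T , tree , there (here eq)
    cases (yes vx) (yes vy) =
      let T , tree , eq , exy = subdivided vx vy in
      T , tree , subst (_∈ extend v x y T) (sym eq) (subdivide∈extend exy)
    cases (no ¬vx) (no ¬vy) = ⊥-elim (spokeless (proj₂ (Walk-firstEdge (connected (inj₂ refl) (inj₁ x∈S)) v≢x)))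
      where
      spokeless : ¬ Edge T′ v w
      spokeless e = [ (λ { refl → ¬vx e }) , (λ { refl → ¬vy e }) ]′ (neighbour e)

  concatMap-extend : ∀ {L} → ListsTreesOn G S L → ListsTreesOn G (S ∪ ｛ v ｝) (concatMap (extend v x y) L)
  concatMap-extend {L} trees = record
    { sound    = λ m → let T , T∈L , m′ = find (∈-concatMap⁻ (extend v x y) m) in
                       extend-isTreeOn (sound T∈L) m′
    ; complete = λ tree′ → let T , tree , m = extend-complete tree′ in
                           ∈-concatMap⁺ (extend v x y) (lose (complete tree) m)
    ; unique   = concatMap-unique (extend v x y) (contract v x y) unique
                   (λ T∈L → extend-unique v≢x v≢y x≢y (isolated T∈L))
                   (λ T∈L → contract-extend v≢x v≢y x≢y (IsTreeOn.undirected (sound T∈L)) (isolated T∈L))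
    }
    where
    open ListsTreesOn trees
    isolated : T ∈ L → Isolated T v
    isolated = IsTreeOn-isolated v∉S ∘ sound

-- The run of the algorithm

Unique-pair : ∀ {l : List (Fin n)} → Unique l → (∀ {j} → j ∈ l → j ≡ a ⊎ j ≡ b) →
  a ∈ l → b ∈ l → a ≢ b →
  l ≡ a ∷ b ∷ [] ⊎ l ≡ b ∷ a ∷ []
Unique-pair {l = []} _ _ () _ _
Unique-pair {l = c ∷ []} _ _ (here refl) (here refl) a≢b = ⊥-elim (a≢b refl)
Unique-pair {l = c ∷ d ∷ []} ((c≢d ∷ []) ∷ _) ∈ab _ _ _
  with SamePair-fromDistinct (∈ab (here refl)) (∈ab (there (here refl))) c≢d
... | inj₁ (refl , refl) = inj₁ refl
... | inj₂ (refl , refl) = inj₂ refl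
Unique-pair {l = c ∷ d ∷ e ∷ _} ((c≢d ∷ c≢e ∷ _) ∷ (d≢e ∷ _) ∷ _) ∈ab _ _ _ =
  ⊥-elim ([ c≢e ∘ sym , d≢e ∘ sym ]′
    (SamePair-covers (SamePair-fromDistinct (∈ab (here refl)) (∈ab (there (here refl))) c≢d)
                     (∈ab (there (there (here refl))))))

-- Otherwise punching out a missed value w gives an injection Fin (suc k) → Fin k.
injective⇒surjective : ∀ {f : Fin n → Fin n} → Injective _≡_ _≡_ f → ∀ w → ∃ λ j → f j ≡ w
injective⇒surjective {n = suc k} {f} f-inj w with anyFin? (λ j → f j ≟ w)
... | yes hit = hit
... | no miss = ⊥-elim (1+n≰n (injective⇒≤ punched-inj))
  where
  punched : Fin (suc k) → Fin k
  punched j = punchOut {i = w} {j = f j} (λ w≡fj → miss (j , sym w≡fj))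
  punched-inj : Injective _≡_ _≡_ punched
  punched-inj {j₁} {j₂} eq = f-inj (punchOut-injective (λ e → miss (j₁ , sym e)) (λ e → miss (j₂ , sym e)) eq)

Earlier : (Fin n → Fin n) → ℕ → Pred (Fin n) 0ℓ
Earlier σ k w = ∃ λ j → toℕ j < k × σ j ≡ w

module _ {σ : Fin n → Fin n} (σ-inj : Injective _≡_ _≡_ σ) where

  σ∉Earlier : ∀ i → ¬ Earlier σ (toℕ i) (σ i)
  σ∉Earlier i (j , j<i , σj≡σi) with σ-inj σj≡σi
  ... | refl = <-irrefl refl j<i

  Earlier-suc : ∀ i → Earlier σ (suc (toℕ i)) ≐ (Earlier σ (toℕ i) ∪ ｛ σ i ｝)
  Earlier-suc i = to , from
    where
    to : ∀ {w} → Earlier σ (suc (toℕ i)) w → (Earlier σ (toℕ i) ∪ ｛ σ i ｝) w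
    to (j , j<1+i , σj≡w) =
      [ (λ j<i → inj₁ (j , j<i , σj≡w)) , (λ j≡i → inj₂ (trans (cong σ (sym (toℕ-injective j≡i))) σj≡w)) ]′
        (m<1+n⇒m<n∨m≡n j<1+i)
    from : ∀ {w} → (Earlier σ (toℕ i) ∪ ｛ σ i ｝) w → Earlier σ (suc (toℕ i)) w
    from (inj₁ (j , j<i , σj≡w)) = j , m<n⇒m<1+n j<i , σj≡w
    from (inj₂ σi≡w)             = i , n<1+n (toℕ i) , σi≡w

  Earlier-all : ∀ w → Earlier σ n w
  Earlier-all w = let j , σj≡w = injective⇒surjective σ-inj w in j , toℕ<n j , σj≡w

  earlierNbrs-simplicial : {G : Adj n} → Undirected G → ∀ i → SimplicialDeg2 G σ i →
    ∃₂ λ x y → earlierNbrs G σ i ≡ x ∷ y ∷ [] × Simplicial2On G (Earlier σ (toℕ i)) (σ i) x y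
  earlierNbrs-simplicial {G = G} undG i (a , b , a<i , b<i , a≢b , nbrs , Gab) =
    [ (λ eq → σ a , σ b , cong (map σ) eq , simplicial) ,
      (λ eq → σ b , σ a , cong (map σ) eq , Simplicial2On-swap undG simplicial) ]′
    (Unique-pair (Unique.filter⁺ (T? ∘ P) (Unique.allFin⁺ n)) ∈ab
                 (earlier a<i (inj₁ refl)) (earlier b<i (inj₂ refl)) a≢b)
    where
    P : Fin n → Bool
    P j = (toℕ j <ᵇ toℕ i) ∧ adj G (σ i) (σ j)
    ∈ab : ∀ {j} → j ∈ filterᵇ P (allFin n) → j ≡ a ⊎ j ≡ b
    ∈ab {j} j∈ = let j<i , e = Equivalence.to T-∧ (proj₂ (∈-filter⁻ (T? ∘ P) {xs = allFin n} j∈)) in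
                 proj₁ (nbrs j (<ᵇ⇒< (toℕ j) (toℕ i) j<i)) (Equivalence.to T-≡ e)
    earlier : ∀ {j} → toℕ j < toℕ i → j ≡ a ⊎ j ≡ b → j ∈ filterᵇ P (allFin n)
    earlier {j} j<i j∈ab = ∈-filter⁺ (T? ∘ P) (∈-allFin j)
                             (Equivalence.from T-∧ (<⇒<ᵇ j<i , Equivalence.from T-≡ (proj₂ (nbrs j j<i) j∈ab)))
    simplicial : Simplicial2On G (Earlier σ (toℕ i)) (σ i) (σ a) (σ b)
    simplicial = record
      { v∉S = σ∉Earlier i ; x∈S = a , a<i , refl ; y∈S = b , b<i , refl ; x≢y = a≢b ∘ σ-inj
      ; Gvx = proj₂ (nbrs a a<i) (inj₁ refl) ; Gvy = proj₂ (nbrs b b<i) (inj₂ refl) ; Gxy = Gab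
      ; neighbours = λ { (j , j<i , refl) e → ⊎-map (cong σ) (cong σ) (proj₁ (nbrs j j<i) e) }
      }

stepAlg-≡ : ∀ {G : Adj n} {σ} L i → earlierNbrs G σ i ≡ x ∷ y ∷ [] →
  stepAlg G σ L i ≡ concatMap (extend (σ i) x y) L
stepAlg-≡ {G = G} {σ} L i eq with earlierNbrs G σ i
stepAlg-≡ L i refl | _ = refl

Consecutive : ℕ → ℕ → List (Fin n) → Set
Consecutive k e []       = k ≡ e
Consecutive k e (i ∷ is) = toℕ i ≡ k × Consecutive (suc k) e is

Consecutive-tabulate : ∀ {j} k (f : Fin j → Fin n) → (∀ t → toℕ (f t) ≡ k + toℕ t) →
  Consecutive k (k + j) (tabulate f)
Consecutive-tabulate {j = zero}  k f _  = sym (+-identityʳ k)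
Consecutive-tabulate {j = suc j} k f f≡ =
  trans (f≡ zero) (+-identityʳ k) ,
  subst (λ e → Consecutive (suc k) e (tabulate (f ∘ suc))) (sym (+-suc k j))
    (Consecutive-tabulate (suc k) (f ∘ suc) λ t → trans (f≡ (suc t)) (+-suc k (toℕ t)))

laterIndices-consecutive : ∀ m → Consecutive 2 (suc (suc m)) (filterᵇ (λ i → 2 ≤ᵇ toℕ i) (allFin (suc (suc m))))
laterIndices-consecutive m =
  subst (Consecutive 2 (suc (suc m))) (sym later≡) (Consecutive-tabulate {j = m} 2 (λ t → suc (suc t)) (λ _ → refl))
  where
  later≡ : filterᵇ (λ i → 2 ≤ᵇ toℕ i) (allFin (suc (suc m))) ≡ tabulate (λ t → suc (suc t))
  later≡ = filter-all (T? ∘ (λ i → 2 ≤ᵇ toℕ i)) (tabulate⁺ {f = λ t → suc (suc t)} (λ _ → tt))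

module _ {G : Adj n} (undG : Undirected G) {σ : Fin n → Fin n} (σ-inj : Injective _≡_ _≡_ σ)
         (simplicial : ∀ i → 2 ≤ toℕ i → SimplicialDeg2 G σ i) where

  stepAlg-listsTrees : ∀ {L} i → 2 ≤ toℕ i → ListsTreesOn G (Earlier σ (toℕ i)) L →
    ListsTreesOn G (Earlier σ (suc (toℕ i))) (stepAlg G σ L i)
  stepAlg-listsTrees {L} i 2≤i trees =
    let x , y , nbrs≡ , simp = earlierNbrs-simplicial σ-inj undG i (simplicial i 2≤i) in
    subst (ListsTreesOn G (Earlier σ (suc (toℕ i)))) (sym (stepAlg-≡ {G = G} L i nbrs≡))
      (ListsTreesOn-resp (×-swap (Earlier-suc σ-inj i)) (concatMap-extend undG simp trees))

  foldl-stepAlg : ∀ {k e L} is → 2 ≤ k → Consecutive k e is → ListsTreesOn G (Earlier σ k) L →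
    ListsTreesOn G (Earlier σ e) (foldl (stepAlg G σ) L is)
  foldl-stepAlg []       _   refl            trees = trees
  foldl-stepAlg (i ∷ is) 2≤k (refl , consec) trees =
    foldl-stepAlg is (m≤n⇒m≤1+n 2≤k) consec (stepAlg-listsTrees i 2≤k trees)

module _ {G : Adj n} (undG : Undirected G) {u w : Fin n} (u≢w : u ≢ w) (Guw : Edge G u w) where

  emptyGraph-isTreeOn : IsTreeOn G ｛ w ｝ emptyGraph
  emptyGraph-isTreeOn = record
    { edge⊆      = λ {a} {b} → ⊥-elim ∘ ¬Edge-emptyGraph a b
    ; undirected = mkUndirected λ a b → trans (adj-emptyGraph a b) (sym (adj-emptyGraph b a))
    ; loopless   = mkLoopless λ a → adj-emptyGraph a a
    ; connected  = λ { refl refl → here }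
    ; acyclic    = λ (v , ws , _ , _ , _ , closing) → ¬Edge-emptyGraph (lastOr v ws) v closing
    }

  singleEdge-listsTrees : ListsTreesOn G (｛ w ｝ ∪ ｛ u ｝) (addEdge u w emptyGraph ∷ [])
  singleEdge-listsTrees = record
    { sound    = λ { (here refl) → addLeaf-isTreeOn undG (u≢w ∘ sym) refl Guw emptyGraph-isTreeOn }
    ; complete = λ tree → here (unique-tree tree)
    ; unique   = [] ∷ []
    }
    where
    ends : (｛ w ｝ ∪ ｛ u ｝) a → a ≡ u ⊎ a ≡ w
    ends = ⊎-swap ∘ ⊎-map sym sym
    unique-tree : IsTreeOn G (｛ w ｝ ∪ ｛ u ｝) T → T ≡ addEdge u w emptyGraph
    unique-tree {T} tree = Edge-ext to from
      where
      open IsTreeOn tree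
      pair : Edge T a b → SamePair u w a b
      pair e = let _ , a∈ , b∈ = edge⊆ e in
               SamePair-fromDistinct (ends a∈) (ends b∈) λ { refl → Loopless⇒¬Edge loopless e }
      euw : Edge T u w
      euw = let _ , e = Walk-firstEdge (connected (inj₂ refl) (inj₁ refl)) u≢w in
            Edge-SamePair undirected (SamePair-sym (pair e)) e
      to : Edge T a b → Edge (addEdge u w emptyGraph) a b
      to e = addEdge-new u w emptyGraph (pair e)
      from : Edge (addEdge u w emptyGraph) a b → Edge T a b
      from {a} {b} e = [ (λ p → Edge-SamePair undirected p euw) , ⊥-elim ∘ ¬Edge-emptyGraph a b ]′ (addEdge⁻ u w emptyGraph e)

<2⇒01 : ∀ {k} (j : Fin (suc (suc k))) → toℕ j < 2 → j ≡ zero ⊎ j ≡ suc zero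
<2⇒01 zero          _              = inj₁ refl
<2⇒01 (suc zero)    _              = inj₂ refl
<2⇒01 (suc (suc _)) (s≤s (s≤s ()))

Fin2-cover : {p q : Fin 2} → p ≢ q → ∀ r → r ≡ p ⊎ r ≡ q
Fin2-cover {zero}     {zero}     p≢q _          = ⊥-elim (p≢q refl)
Fin2-cover {suc zero} {suc zero} p≢q _          = ⊥-elim (p≢q refl)
Fin2-cover {zero}     {suc zero} _   zero       = inj₁ refl
Fin2-cover {zero}     {suc zero} _   (suc zero) = inj₂ refl
Fin2-cover {suc zero} {zero}     _   zero       = inj₂ refl
Fin2-cover {suc zero} {zero}     _   (suc zero) = inj₁ refl

module _ {m : ℕ} {σ : Fin (suc (suc m)) → Fin (suc (suc m))} (σ-inj : Injective _≡_ _≡_ σ) where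

  σ₀≢σ₁ : σ zero ≢ σ (suc zero)
  σ₀≢σ₁ = (λ ()) ∘ σ-inj

  initial-listsTrees : {G : Adj (suc (suc m))} → Undirected G → Edge G (σ zero) (σ (suc zero)) →
    ListsTreesOn G (Earlier σ 2) (addEdge (σ zero) (σ (suc zero)) emptyGraph ∷ [])
  initial-listsTrees undG Gσ₀σ₁ = ListsTreesOn-resp (from , to) (singleEdge-listsTrees undG σ₀≢σ₁ Gσ₀σ₁)
    where
    to : ∀ {w} → Earlier σ 2 w → (｛ σ (suc zero) ｝ ∪ ｛ σ zero ｝) w
    to (j , j<2 , σj≡w) = [ (λ { refl → inj₂ σj≡w }) , (λ { refl → inj₁ σj≡w }) ]′ (<2⇒01 j j<2)
    from : ∀ {w} → (｛ σ (suc zero) ｝ ∪ ｛ σ zero ｝) w → Earlier σ 2 w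
    from (inj₁ refl) = suc zero , s≤s (s≤s z≤n) , refl
    from (inj₂ refl) = zero , s≤s z≤n , refl

-- From the initial K₂ of the 2-tree when n = 2, and from the neighbours of v₃ otherwise.
firstEdge : ∀ m {G : Adj (suc (suc m))} (σ : Ordering (suc (suc m))) → Undirected G → IsTwoTree G →
  Is2SimplicialOrdering G σ → Edge G (proj₁ σ zero) (proj₁ σ (suc zero))
firstEdge zero (σ , σ-inj) undG (_ , (τ , τ-inj) , (a , b , a≡0 , b≡1 , Gτaτb) , _) _ =
  Edge-SamePair undG (SamePair-sym (SamePair-fromDistinct (cover (τ a)) (cover (τ b)) τa≢τb)) Gτaτb
  where
  cover : ∀ r → r ≡ σ zero ⊎ r ≡ σ (suc zero)
  cover = Fin2-cover (σ₀≢σ₁ σ-inj)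
  τa≢τb : τ a ≢ τ b
  τa≢τb τa≡τb = 0≢1+n (trans (sym a≡0) (trans (cong toℕ (τ-inj τa≡τb)) b≡1))
firstEdge (suc m) (σ , _) undG _ simplicial with simplicial (suc (suc zero)) (s≤s (s≤s z≤n))
... | a , b , a<2 , b<2 , a≢b , _ , Gab with SamePair-fromDistinct (<2⇒01 a a<2) (<2⇒01 b b<2) a≢b
...   | inj₁ (refl , refl) = Gab
...   | inj₂ (refl , refl) = Edge-flip undG Gab

theorem2p2 : (m : ℕ) (G : Adj (suc (suc m))) → IsTwoTree G →
    (σ : Ordering (suc (suc m))) → Is2SimplicialOrdering G σ →
    (∀ T → T ∈ algorithm G σ → IsSpanningTree G T) ×
    (∀ T → IsSpanningTree G T → T ∈ algorithm G σ) ×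
    Unique (algorithm G σ)
theorem2p2 m G twoTree@(simple , _) (σ , σ-inj) simplicial =
  (λ _ → IsTreeOn⇒IsSpanningTree (Earlier-all σ-inj) ∘ sound) ,
  (λ _ → complete ∘ IsSpanningTree⇒IsTreeOn (Earlier-all σ-inj)) ,
  unique
  where
  undG : Undirected G
  undG = mkUndirected (proj₁ simple)
  open ListsTreesOn
    (foldl-stepAlg undG σ-inj simplicial _ (s≤s (s≤s z≤n)) (laterIndices-consecutive m)
      (initial-listsTrees σ-inj undG (firstEdge m (σ , σ-inj) undG twoTree simplicial)))
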